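{- Let $A\in \mathbb{Z}^{m\times n}$ and $b\in \mathbb{Z}^m$, and let $p,q$ be distinct primes. If $Ax=b$ has a $p$-adic solution and a $q$-adic solution, then $Ax=b$ has an integral solution.
   Context: For a prime $p$, a $p$-adic rational is a number of the form $a/p^k$ with $a,k$ integers and $k\geq 0$; a vector is $p$-adic if all its entries are $p$-adic rationals. -}

module Defs where

open import Data.Nat using (ℕ; NonZero; _^_)
open import Data.Nat.Properties using (m^n≢0)
open import Data.Integer using (ℤ)
open import Data.Rational using (ℚ; _+_; _*_; 0ℚ) renaming (_/_ to _/ℚ_)
import Data.Rational as Q
open import Data.Fin using (Fin; zero; suc)
open import Data.Product using (∃; ∃-syntax; _×_)
open import Relation.Binary.PropositionalEquality using (_≡_)

∑ : ∀ {n} → (Fin n → ℚ) → ℚ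
∑ {ℕ.zero} f = 0ℚ
∑ {ℕ.suc n} f = f zero + ∑ (λ j → f (suc j))

Matℤ : ℕ → ℕ → Set
Matℤ m n = Fin m → Fin n → ℤ

Vecℤ : ℕ → Set
Vecℤ m = Fin m → ℤ

Vecℚ : ℕ → Set
Vecℚ n = Fin n → ℚ

IsSolution : ∀ {m n} → Matℤ m n → Vecℤ m → Vecℚ n → Set
IsSolution A b x = ∀ i → ∑ (λ j → ((A i j) /ℚ 1) * x j) ≡ ((b i) /ℚ 1)

IsPAdicRational : (p : ℕ) → .{{NonZero p}} → ℚ → Set
IsPAdicRational p r = ∃[ a ] ∃[ k ] (r ≡ (_/ℚ_ a (p ^ k) {{m^n≢0 p k}}))

IsPAdicVec : ∀ {n} (p : ℕ) → .{{NonZero p}} → Vecℚ n → Set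
IsPAdicVec p x = ∀ j → IsPAdicRational p (x j)

IsIntegralVec : ∀ {n} → Vecℚ n → Set
IsIntegralVec x = ∀ j → ∃[ a ] (x j ≡ (a /ℚ 1))

{-# OPTIONS --safe #-}
-- Clearing denominators, p^K x and q^L y are integral vectors for suitable K and L.
-- As p^K and q^L are coprime, Bézout gives integers S, T with S p^K + T q^L = 1,
-- so z = S p^K x + T q^L y is an affine combination of two solutions, hence a
-- solution, and it is integral.
module Submission where

open import Algebra.Bundles using (CommutativeRing)
open import Data.Fin using (zero; suc)
open import Data.Integer using (ℤ; +_; -_; 1ℤ) renaming (_+_ to _+ℤ_; _*_ to _*ℤ_)
import Data.Integer.Properties as ℤ
open import Data.Integer.Tactic.RingSolver using (solve-∀)
open import Data.Nat using (ℕ; zero; suc; NonZero; _^_) renaming (_+_ to _+ℕ_; _*_ to _*ℕ_)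
import Data.Nat.Properties as ℕ
open import Data.Nat.Coprimality as Coprime using (Coprime; coprime-Bézout; coprime-divisor)
open import Data.Nat.Divisibility using (∣-trans; ∣1⇒≡1)
open import Data.Nat.GCD using (module Bézout)
open import Data.Nat.Primality using (Prime; prime⇒nonZero; prime⇒irreducible)
open import Data.Empty using (⊥-elim)
open import Data.Product using (∃-syntax; _×_; _,_)
open import Data.Rational using (ℚ; _+_; _*_; 1ℚ; toℚᵘ) renaming (_/_ to _/ℚ_)
open import Data.Rational.Properties
  using (+-*-commutativeRing; *-assoc; *-comm; *-identityˡ; *-distribˡ-+; *-distribʳ-+; toℚᵘ-injective; toℚᵘ-fromℚᵘ; toℚᵘ-homo-+; toℚᵘ-homo-*)
open import Data.Rational.Unnormalised as ℚᵘ using (mkℚᵘ; *≡*; _≃_)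
import Data.Rational.Unnormalised.Properties as ℚᵘ
open import Data.Sum using (inj₁; inj₂)
open import Relation.Binary.PropositionalEquality

open import Defs

open import Algebra.Properties.Semiring.Sum (CommutativeRing.semiring +-*-commutativeRing)
  using (sum; ∑-distrib-+; *-distribˡ-sum; sum-cong-≗)
open import Algebra.Properties.CommutativeSemigroup (CommutativeRing.*-commutativeSemigroup +-*-commutativeRing)
  using (x∙yz≈y∙xz)

distinct-primes-coprime : ∀ {p q} → Prime p → Prime q → p ≢ q → Coprime p q
distinct-primes-coprime pp qp p≢q (d∣p , d∣q) with prime⇒irreducible pp d∣p
... | inj₁ d≡1 = d≡1
... | inj₂ refl with prime⇒irreducible qp d∣q
...   | inj₁ d≡1 = d≡1
...   | inj₂ d≡q = ⊥-elim (p≢q d≡q)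

coprime-*ʳ : ∀ {a b c} → Coprime a b → Coprime a c → Coprime a (b *ℕ c)
coprime-*ʳ {b = b} a⊥b a⊥c {d} (d∣a , d∣bc) = a⊥c (d∣a , coprime-divisor d⊥b d∣bc)
  where
  d⊥b : Coprime d b
  d⊥b (e∣d , e∣b) = a⊥b (∣-trans e∣d d∣a , e∣b)

coprime-^ʳ : ∀ {a b} k → Coprime a b → Coprime a (b ^ k)
coprime-^ʳ zero    a⊥b (_ , d∣1) = ∣1⇒≡1 d∣1
coprime-^ʳ (suc k) a⊥b = coprime-*ʳ a⊥b (coprime-^ʳ k a⊥b)

coprime-^ : ∀ {a b} k l → Coprime a b → Coprime (a ^ k) (b ^ l)
coprime-^ k l a⊥b = Coprime.sym (coprime-^ʳ k (Coprime.sym (coprime-^ʳ l a⊥b)))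

sum≡⇒difference≡ : ∀ {d m n} x y → d +ℕ y *ℕ n ≡ x *ℕ m → + x *ℤ + m +ℤ - + y *ℤ + n ≡ + d
sum≡⇒difference≡ {d} {m} {n} x y eq = begin
  + x *ℤ + m +ℤ - + y *ℤ + n        ≡⟨ cong (_+ℤ - + y *ℤ + n) lift ⟩
  + d +ℤ + y *ℤ + n +ℤ - + y *ℤ + n  ≡⟨ cancel (+ d) (+ y) (+ n) ⟩
  + d                               ∎
  where
  open ≡-Reasoning
  lift : + x *ℤ + m ≡ + d +ℤ + y *ℤ + n
  lift = begin
    + x *ℤ + m         ≡⟨ ℤ.pos-* x m ⟨
    + (x *ℕ m)         ≡⟨ cong +_ eq ⟨
    + (d +ℕ y *ℕ n)    ≡⟨ ℤ.pos-+ d (y *ℕ n) ⟩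
    + d +ℤ + (y *ℕ n)  ≡⟨ cong (+ d +ℤ_) (ℤ.pos-* y n) ⟩
    + d +ℤ + y *ℤ + n  ∎
  cancel : ∀ a b c → a +ℤ b *ℤ c +ℤ - b *ℤ c ≡ a
  cancel = solve-∀

ℤ-bézout : ∀ {d m n} → Bézout.Identity d m n → ∃[ s ] ∃[ t ] (s *ℤ + m +ℤ t *ℤ + n ≡ + d)
ℤ-bézout (Bézout.+- x y eq) = + x , - + y , sum≡⇒difference≡ x y eq
ℤ-bézout (Bézout.-+ x y eq) = - + x , + y , trans (ℤ.+-comm (- + x *ℤ _) _) (sum≡⇒difference≡ y x eq)

fromℤ : ℤ → ℚ
fromℤ a = a /ℚ 1

toℚᵘ-/ : ∀ a d → toℚᵘ (a /ℚ suc d) ≃ mkℚᵘ a d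
toℚᵘ-/ a d = toℚᵘ-fromℚᵘ (mkℚᵘ a d)

fromℤ-homo-+ : ∀ a b → fromℤ (a +ℤ b) ≡ fromℤ a + fromℤ b
fromℤ-homo-+ a b = toℚᵘ-injective (begin
  toℚᵘ (fromℤ (a +ℤ b))               ≈⟨ toℚᵘ-/ (a +ℤ b) 0 ⟩
  mkℚᵘ (a +ℤ b) 0                     ≈⟨ *≡* (distrib a b) ⟩
  mkℚᵘ a 0 ℚᵘ.+ mkℚᵘ b 0              ≈⟨ ℚᵘ.+-cong (toℚᵘ-/ a 0) (toℚᵘ-/ b 0) ⟨
  toℚᵘ (fromℤ a) ℚᵘ.+ toℚᵘ (fromℤ b)  ≈⟨ toℚᵘ-homo-+ (fromℤ a) (fromℤ b) ⟨
  toℚᵘ (fromℤ a + fromℤ b)            ∎)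
  where
  open ℚᵘ.≃-Reasoning
  distrib : ∀ a b → (a +ℤ b) *ℤ 1ℤ ≡ (a *ℤ 1ℤ +ℤ b *ℤ 1ℤ) *ℤ 1ℤ
  distrib = solve-∀

fromℤ-homo-* : ∀ a b → fromℤ (a *ℤ b) ≡ fromℤ a * fromℤ b
fromℤ-homo-* a b = toℚᵘ-injective (begin
  toℚᵘ (fromℤ (a *ℤ b))               ≈⟨ toℚᵘ-/ (a *ℤ b) 0 ⟩
  mkℚᵘ (a *ℤ b) 0                     ≈⟨ *≡* refl ⟩
  mkℚᵘ a 0 ℚᵘ.* mkℚᵘ b 0              ≈⟨ ℚᵘ.*-cong (toℚᵘ-/ a 0) (toℚᵘ-/ b 0) ⟨
  toℚᵘ (fromℤ a) ℚᵘ.* toℚᵘ (fromℤ b)  ≈⟨ toℚᵘ-homo-* (fromℤ a) (fromℤ b) ⟨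
  toℚᵘ (fromℤ a * fromℤ b)            ∎)
  where open ℚᵘ.≃-Reasoning

/-*-cancel : ∀ a n .{{_ : NonZero n}} → (a /ℚ n) * fromℤ (+ n) ≡ fromℤ a
/-*-cancel a n@(suc d) = toℚᵘ-injective (begin
  toℚᵘ ((a /ℚ n) * fromℤ (+ n))             ≈⟨ toℚᵘ-homo-* (a /ℚ n) (fromℤ (+ n)) ⟩
  toℚᵘ (a /ℚ n) ℚᵘ.* toℚᵘ (fromℤ (+ n))     ≈⟨ ℚᵘ.*-cong (toℚᵘ-/ a d) (toℚᵘ-/ (+ n) 0) ⟩
  mkℚᵘ a d ℚᵘ.* mkℚᵘ (+ n) 0                ≈⟨ *≡* cancel ⟩
  mkℚᵘ a 0                                  ≈⟨ toℚᵘ-/ a 0 ⟨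
  toℚᵘ (fromℤ a)                            ∎)
  where
  open ℚᵘ.≃-Reasoning
  cancel : (a *ℤ + n) *ℤ 1ℤ ≡ a *ℤ + (n *ℕ 1)
  cancel = trans (ℤ.*-identityʳ _) (cong (λ k → a *ℤ + k) (sym (ℕ.*-identityʳ n)))

IsIntegral : ℚ → Set
IsIntegral r = ∃[ a ] (r ≡ fromℤ a)

isIntegral-+ : ∀ {r s} → IsIntegral r → IsIntegral s → IsIntegral (r + s)
isIntegral-+ (a , refl) (b , refl) = a +ℤ b , sym (fromℤ-homo-+ a b)

isIntegral-* : ∀ {r s} → IsIntegral r → IsIntegral s → IsIntegral (r * s)
isIntegral-* (a , refl) (b , refl) = a *ℤ b , sym (fromℤ-homo-* a b)

HasDenominator : ℕ → ℚ → Set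
HasDenominator d r = IsIntegral (r * fromℤ (+ d))

hasDenominator-*ʳ : ∀ {d r} e → HasDenominator d r → HasDenominator (d *ℕ e) r
hasDenominator-*ʳ {d} {r} e r*d-integral =
  subst IsIntegral (sym reassoc) (isIntegral-* r*d-integral (+ e , refl))
  where
  reassoc : r * fromℤ (+ (d *ℕ e)) ≡ r * fromℤ (+ d) * fromℤ (+ e)
  reassoc = begin
    r * fromℤ (+ (d *ℕ e))            ≡⟨ cong (λ k → r * fromℤ k) (ℤ.pos-* d e) ⟩
    r * fromℤ (+ d *ℤ + e)            ≡⟨ cong (r *_) (fromℤ-homo-* (+ d) (+ e)) ⟩
    r * (fromℤ (+ d) * fromℤ (+ e))   ≡⟨ *-assoc r _ _ ⟨
    r * fromℤ (+ d) * fromℤ (+ e)     ∎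
    where open ≡-Reasoning

pAdic⇒hasDenominator : ∀ p .{{_ : NonZero p}} {r} → IsPAdicRational p r → ∃[ k ] HasDenominator (p ^ k) r
pAdic⇒hasDenominator p (a , k , refl) = k , a , /-*-cancel a (p ^ k) {{ℕ.m^n≢0 p k}}

hasDenominator-^-+ : ∀ p {k r} l → HasDenominator (p ^ k) r → HasDenominator (p ^ (k +ℕ l)) r
hasDenominator-^-+ p {k} {r} l den = subst (λ d → HasDenominator d r) (sym (ℕ.^-distribˡ-+-* p k l))
  (hasDenominator-*ʳ {p ^ k} {r} (p ^ l) den)

commonPowerDenominator : ∀ {n} p (x : Vecℚ n) →
  (∀ j → ∃[ k ] HasDenominator (p ^ k) (x j)) → ∃[ K ] ∀ j → HasDenominator (p ^ K) (x j)
commonPowerDenominator {zero}  p x hasDen = 0 , λ ()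
commonPowerDenominator {suc n} p x hasDen
  with hasDen zero | commonPowerDenominator p (λ j → x (suc j)) (λ j → hasDen (suc j))
... | k , x₀-den | K , xₛ-den = k +ℕ K , den
  where
  den : ∀ j → HasDenominator (p ^ (k +ℕ K)) (x j)
  den zero    = hasDenominator-^-+ p {k} {x zero} K x₀-den
  den (suc j) = subst (λ e → HasDenominator (p ^ e) (x (suc j))) (ℕ.+-comm K k)
                  (hasDenominator-^-+ p {K} {x (suc j)} k (xₛ-den j))

scaledDenominator-isIntegral : ∀ {d r} a → HasDenominator d r → IsIntegral (fromℤ a * fromℤ (+ d) * r)
scaledDenominator-isIntegral {d} {r} a r*d-integral =
  subst IsIntegral reassoc (isIntegral-* (a , refl) r*d-integral)
  where
  reassoc : fromℤ a * (r * fromℤ (+ d)) ≡ fromℤ a * fromℤ (+ d) * r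
  reassoc = trans (cong (fromℤ a *_) (*-comm r _)) (sym (*-assoc (fromℤ a) _ r))

coprime⇒ℚ-bézout : ∀ {m n} → Coprime m n →
  ∃[ s ] ∃[ t ] (fromℤ s * fromℤ (+ m) + fromℤ t * fromℤ (+ n) ≡ 1ℚ)
coprime⇒ℚ-bézout {m} {n} m⊥n with ℤ-bézout (coprime-Bézout m⊥n)
... | s , t , sm+tn≡1 = s , t , (begin
  fromℤ s * fromℤ (+ m) + fromℤ t * fromℤ (+ n)  ≡⟨ cong₂ _+_ (fromℤ-homo-* s (+ m)) (fromℤ-homo-* t (+ n)) ⟨
  fromℤ (s *ℤ + m) + fromℤ (t *ℤ + n)            ≡⟨ fromℤ-homo-+ (s *ℤ + m) (t *ℤ + n) ⟨
  fromℤ (s *ℤ + m +ℤ t *ℤ + n)                   ≡⟨ cong fromℤ sm+tn≡1 ⟩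
  1ℚ                                             ∎)
  where open ≡-Reasoning

∑≡sum : ∀ {n} (f : Vecℚ n) → ∑ f ≡ sum f
∑≡sum {zero}  f = refl
∑≡sum {suc n} f = cong (λ r → f zero + r) (∑≡sum (λ j → f (suc j)))

solution-affine : ∀ {m n} (A : Matℤ m n) (b : Vecℤ m) {x y : Vecℚ n} s t → s + t ≡ 1ℚ →
  IsSolution A b x → IsSolution A b y → IsSolution A b (λ j → s * x j + t * y j)
solution-affine {n = n} A b {x} {y} s t s+t≡1 Ax≡b Ay≡b i = begin
  ∑ (λ j → a j * (s * x j + t * y j))                        ≡⟨ ∑≡sum (λ j → a j * (s * x j + t * y j)) ⟩
  sum (λ j → a j * (s * x j + t * y j))                      ≡⟨ sum-cong-≗ (λ j → distribute (a j) (x j) (y j)) ⟩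
  sum (λ j → s * (a j * x j) + t * (a j * y j))              ≡⟨ ∑-distrib-+ (λ j → s * (a j * x j)) _ ⟩
  sum (λ j → s * (a j * x j)) + sum (λ j → t * (a j * y j))  ≡⟨ cong₂ _+_ (*-distribˡ-sum s ax) (*-distribˡ-sum t ay) ⟨
  s * sum ax + t * sum ay                                    ≡⟨ cong₂ (λ u v → s * u + t * v) (∑≡sum ax) (∑≡sum ay) ⟨
  s * ∑ ax + t * ∑ ay                                        ≡⟨ cong₂ (λ u v → s * u + t * v) (Ax≡b i) (Ay≡b i) ⟩
  s * β + t * β                                              ≡⟨ *-distribʳ-+ β s t ⟨
  (s + t) * β                                                ≡⟨ cong (_* β) s+t≡1 ⟩
  1ℚ * β                                                     ≡⟨ *-identityˡ β ⟩
  β                                                          ∎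
  where
  open ≡-Reasoning
  a : Vecℚ n
  a j = fromℤ (A i j)
  ax ay : Vecℚ n
  ax j = a j * x j
  ay j = a j * y j
  β : ℚ
  β = fromℤ (b i)
  distribute : ∀ c u v → c * (s * u + t * v) ≡ s * (c * u) + t * (c * v)
  distribute c u v = trans (*-distribˡ-+ c (s * u) (t * v)) (cong₂ _+_ (x∙yz≈y∙xz c s u) (x∙yz≈y∙xz c t v))

bézoutCombination-integralSolution : ∀ {m n} (A : Matℤ m n) (b : Vecℤ m) {P Q} {x y : Vecℚ n} S T →
  fromℤ S * fromℤ (+ P) + fromℤ T * fromℤ (+ Q) ≡ 1ℚ →
  (∀ j → HasDenominator P (x j)) → (∀ j → HasDenominator Q (y j)) →
  IsSolution A b x → IsSolution A b y → ∃[ z ] (IsIntegralVec z × IsSolution A b z)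
bézoutCombination-integralSolution {n = n} A b {P} {Q} {x} {y} S T s+t≡1 x-den y-den Ax≡b Ay≡b =
  z , z-integral , solution-affine A b s t s+t≡1 Ax≡b Ay≡b
  where
  s t : ℚ
  s = fromℤ S * fromℤ (+ P)
  t = fromℤ T * fromℤ (+ Q)
  z : Vecℚ n
  z j = s * x j + t * y j
  z-integral : IsIntegralVec z
  z-integral j = isIntegral-+ (scaledDenominator-isIntegral {P} {x j} S (x-den j))
                              (scaledDenominator-isIntegral {Q} {y j} T (y-den j))

corollary2p5 : ∀ {m n} (A : Matℤ m n) (b : Vecℤ m) (p q : ℕ)
    (pp : Prime p) (qp : Prime q) → p ≢ q →
    (∃[ x ] (IsPAdicVec p {{prime⇒nonZero pp}} x × IsSolution A b x)) →
    (∃[ y ] (IsPAdicVec q {{prime⇒nonZero qp}} y × IsSolution A b y)) →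
    ∃[ z ] (IsIntegralVec z × IsSolution A b z)
corollary2p5 A b p q pp qp p≢q (x , x-pAdic , Ax≡b) (y , y-pAdic , Ay≡b)
  with commonPowerDenominator p x (λ j → pAdic⇒hasDenominator p {{prime⇒nonZero pp}} (x-pAdic j))
     | commonPowerDenominator q y (λ j → pAdic⇒hasDenominator q {{prime⇒nonZero qp}} (y-pAdic j))
... | K , x-den | L , y-den =
  -- `let` rather than `with`: abstracting over this equation makes Agda normalise
  -- the rational literals in it, which does not terminate in reasonable memory.
  let S , T , bézout-identity = coprime⇒ℚ-bézout (coprime-^ K L (distinct-primes-coprime pp qp p≢q))
  in bézoutCombination-integralSolution A b {p ^ K} {q ^ L} S T bézout-identity x-den y-den Ax≡b Ay≡b
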